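{- If $G$ is a graph with $\mathrm{prox}_1(G)\ge \Delta(G)^2$, then $\zeta_1(G)=\mathrm{prox}_1(G)$.
   Context: All graphs are finite, connected, and without multiple edges. For a vertex $x$, $N(x)$ is its set of neighbours ($x\notin N(x)$) and $N[x]=N(x)\cup\{x\}$; $\Delta(G)$ is the maximum degree. The one-visibility Localization game with $k$ cops on a graph $G$: the robber first chooses a starting vertex; then in each round the cops choose (probe) vertices $u_1,\dots,u_k$ of $G$ (any vertices), and for each $i$ the probe returns $0$ if the robber is on $u_i$, $1$ if the robber is adjacent to $u_i$, and $\ast$ otherwise; then the robber moves to a vertex of $N[v]$, where $v$ is its current vertex. The cops win if after finitely many rounds the information obtained determines the robber's current vertex uniquely; the robber is omniscient. $\zeta_1(G)$ is the least positive integer $k$ such that $k$ cops have a winning strategy. The one-proximity game is the same except that the cops win as soon as some probe returns a value other than $\ast$; $\mathrm{prox}_1(G)$ is the least number of cops having a winning strategy in it. -}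

module Defs where

open import Level using (0ℓ) renaming (suc to lsuc)
open import Data.Nat using (ℕ; zero; suc; _≤_; _⊔_)
open import Data.Fin using (Fin)
open import Data.Bool using (Bool; true; false; if_then_else_)
open import Data.List using (List; map; foldr; allFin)
open import Data.Nat.ListAction using (sum)
open import Data.Fin.Properties using (_≟_)
open import Relation.Nullary using (yes; no)
open import Data.Product using (Σ; ∃; _×_; _,_)
open import Data.Sum using (_⊎_)
open import Data.Unit using (⊤)
open import Relation.Binary.PropositionalEquality using (_≡_)
open import Relation.Nullary using (¬_)

data Walk {n : ℕ} (adj : Fin n → Fin n → Bool) : Fin n → Fin n → Set where
  here : ∀ {u} → Walk adj u u
  step : ∀ {u w v} → adj u w ≡ true → Walk adj w v → Walk adj u v

record Graph : Set where
  field
    n         : ℕ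
    adj       : Fin n → Fin n → Bool
    symmetric : ∀ u v → adj u v ≡ adj v u
    irrefl    : ∀ v → adj v v ≡ false
    nonempty  : Fin n
    connected : ∀ u v → Walk adj u v

module _ (G : Graph) where
  open Graph G

  Adj : Fin n → Fin n → Set
  Adj u v = adj u v ≡ true

  degree : Fin n → ℕ
  degree v = sum (map (λ u → if adj v u then 1 else 0) (allFin n))

  Δ : ℕ
  Δ = foldr _⊔_ 0 (map degree (allFin n))

  VSet : Set₁
  VSet = Fin n → Set

  N[_] : VSet → VSet
  N[ S ] u = ∃ λ v → S v × (u ≡ v ⊎ Adj v u)

data Resp : Set where
  zeroR oneR starR : Resp

module _ (G : Graph) where
  open Graph G

  resp : Fin n → Fin n → Resp
  resp u v with u ≟ v
  ... | yes _ = zeroR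
  ... | no  _ = if adj u v then oneR else starR

  SameAns : {k : ℕ} → (Fin k → Fin n) → Fin n → Fin n → Set
  SameAns P u v = ∀ i → resp (P i) u ≡ resp (P i) v

  AllStar : {k : ℕ} → (Fin k → Fin n) → Fin n → Set
  AllStar P v = ∀ i → resp (P i) v ≡ starR

  -- LocWin k S : k cops win the one-visibility Localization game when the set
  -- of robber positions consistent with the information so far is S (before
  -- the next probe).  Inductive = the cops win in finitely many rounds, with
  -- probes chosen adaptively from the answers received.
  data LocWin (k : ℕ) : VSet G → Set₁ where
    round : ∀ {S : VSet G} (P : Fin k → Fin n) →
      (∀ v → S v →
        (∀ u → S u → SameAns P u v → u ≡ v)
        ⊎ LocWin k (N[_] G (λ u → S u × SameAns P u v))) →
      LocWin k S

  -- ProxWin k S : same for the one-proximity game (cops win as soon as a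
  -- probe answers something other than ∗).
  data ProxWin (k : ℕ) : VSet G → Set₁ where
    round : ∀ {S : VSet G} (P : Fin k → Fin n) →
      ((∀ v → S v → ¬ AllStar P v)
        ⊎ ProxWin k (N[_] G (λ u → S u × AllStar P u))) →
      ProxWin k S

  LocCopsWin : ℕ → Set₁
  LocCopsWin k = LocWin k (λ _ → ⊤)

  ProxCopsWin : ℕ → Set₁
  ProxCopsWin k = ProxWin k (λ _ → ⊤)

  IsZeta1 : ℕ → Set₁
  IsZeta1 m = 1 ≤ m × LocCopsWin m × (∀ k → 1 ≤ k → LocCopsWin k → m ≤ k)

  IsProx1 : ℕ → Set₁
  IsProx1 m = 1 ≤ m × ProxCopsWin m × (∀ k → 1 ≤ k → ProxCopsWin k → m ≤ k)

-- A localization strategy with k ≥ 1 cops is a proximity strategy: play the same probes; while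
-- every answer is ∗ the robber is confined to the positions the localization strategy still
-- considers, and once that strategy has pinned the robber to v, probing v next round sees it.
-- Conversely, if Δ² ≤ k, follow a proximity strategy until some probe at c answers 0 or 1.
-- The robber is then within distance 2 of c, and the at most Δ² such vertices other than c
-- can all be probed in one round: each of them answers 0 exactly when the robber is on it,
-- and if none does, the robber is on c.
module Submission where

open import Defs
open import Data.Nat using (ℕ; suc; _≤_; _*_; _⊔_; s≤s; z≤n)
open import Data.Nat.Properties using (≤-trans; ≤-reflexive; m≤m⊔n; m≤n⊔m; +-mono-≤; *-monoˡ-≤)
open import Data.Fin using (Fin) renaming (zero to fzero; suc to fsuc)
open import Data.Fin.Properties using (_≟_; any?; all?; ¬∀⟶∃¬)
open import Data.Bool using (Bool; true; false; if_then_else_; T)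
import Data.Bool.Properties as Bool
open import Data.List using (List; []; _∷_; map; foldr; allFin; length; concatMap; filterᵇ)
open import Data.List.Properties using (length-++; length-map)
open import Data.List.Relation.Unary.Any using (here; there)
open import Data.List.Membership.Propositional using (_∈_; lose)
open import Data.List.Membership.Propositional.Properties
  using (∈-allFin; ∈-map⁺; ∈-filter⁺; ∈-concatMap⁺)
open import Data.Nat.ListAction using (sum)
open import Data.Product using (∃; _,_)
import Data.Product as Product
open import Data.Sum using (_⊎_; inj₁; inj₂)
open import Data.Unit using (tt)
open import Data.Empty using (⊥-elim)
open import Function using (id; _∘_)
open import Relation.Nullary using (Dec; yes; no; does)
open import Relation.Nullary.Decidable using (_×-dec_; _⊎-dec_; T?)
open import Relation.Unary using (Decidable; _⊆_; _∩_; ｛_｝)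
open import Relation.Binary.PropositionalEquality using (_≡_; _≢_; refl; sym; trans; cong; subst)

module _ {A : Set} where

  enumerate : A → (xs : List A) {m : ℕ} → length xs ≤ m → Fin m → A
  enumerate d []       _        _        = d
  enumerate d (x ∷ xs) (s≤s _)  fzero    = x
  enumerate d (x ∷ xs) (s≤s le) (fsuc i) = enumerate d xs le i

  enumerate-surjective : ∀ d xs {m} (le : length xs ≤ m) {x} →
    x ∈ xs → ∃ λ i → enumerate d xs le i ≡ x
  enumerate-surjective d (x ∷ xs) (s≤s le) (here refl) = fzero , refl
  enumerate-surjective d (y ∷ xs) (s≤s le) (there x∈xs) =
    Product.map fsuc id (enumerate-surjective d xs le x∈xs)

  length-concatMap-≤ : ∀ (f : A → List A) xs {b} →
    (∀ {x} → x ∈ xs → length (f x) ≤ b) → length (concatMap f xs) ≤ length xs * b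
  length-concatMap-≤ f []       bound = z≤n
  length-concatMap-≤ f (x ∷ xs) bound = ≤-trans
    (≤-reflexive (length-++ (f x)))
    (+-mono-≤ (bound (here refl)) (length-concatMap-≤ f xs (λ x∈xs → bound (there x∈xs))))

  length-filterᵇ : ∀ (p : A → Bool) xs →
    length (filterᵇ p xs) ≡ sum (map (λ x → if p x then 1 else 0) xs)
  length-filterᵇ p []       = refl
  length-filterᵇ p (x ∷ xs) with p x
  ... | true  = cong suc (length-filterᵇ p xs)
  ... | false = length-filterᵇ p xs

  ≤-foldr-⊔ : ∀ (g : A → ℕ) {x} xs → x ∈ xs → g x ≤ foldr _⊔_ 0 (map g xs)
  ≤-foldr-⊔ g (y ∷ xs) (here refl)  = m≤m⊔n (g y) _
  ≤-foldr-⊔ g (y ∷ xs) (there x∈xs) = ≤-trans (≤-foldr-⊔ g xs x∈xs) (m≤n⊔m (g y) _)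

_≟∗ : (r : Resp) → Dec (r ≡ starR)
zeroR ≟∗ = no λ ()
oneR  ≟∗ = no λ ()
starR ≟∗ = yes refl

module _ (G : Graph) where
  open Graph G

  N-mono : {A B : VSet G} → A ⊆ B → N[ G ] A ⊆ N[ G ] B
  N-mono A⊆B (v , v∈A , close) = v , A⊆B v∈A , close

  N? : {A : VSet G} → Decidable A → Decidable (N[ G ] A)
  N? A? x = any? (λ v → A? v ×-dec ((x ≟ v) ⊎-dec (adj v x Bool.≟ true)))

  allStar? : ∀ {k} (P : Fin k → Fin n) → Decidable (AllStar G P)
  allStar? P v = all? (λ i → resp G (P i) v ≟∗)

  resp-self : ∀ u → resp G u u ≡ zeroR
  resp-self u with u ≟ u
  ... | yes _   = refl
  ... | no  u≢u = ⊥-elim (u≢u refl)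

  resp≡0⇒≡ : ∀ u v → resp G u v ≡ zeroR → u ≡ v
  resp≡0⇒≡ u v r≡0 with u ≟ v
  ... | yes u≡v = u≡v
  ... | no _ with adj u v
  resp≡0⇒≡ u v () | no _ | true
  resp≡0⇒≡ u v () | no _ | false

  resp≢∗⇒∈N : ∀ u v → resp G u v ≢ starR → N[ G ] ｛ u ｝ v
  resp≢∗⇒∈N u v r≢∗ with u ≟ v
  ... | yes refl = u , refl , inj₁ refl
  ... | no _ with adj u v in u~v
  ...   | true  = u , refl , inj₂ u~v
  ...   | false = ⊥-elim (r≢∗ refl)

  ∈N⇒resp≢∗ : ∀ u v → N[ G ] ｛ u ｝ v → resp G u v ≢ starR
  ∈N⇒resp≢∗ u v (u , refl , inj₁ refl) = subst (_≢ starR) (sym (resp-self u)) λ ()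
  ∈N⇒resp≢∗ u v (u , refl , inj₂ u~v) with u ≟ v
  ... | yes _ = λ ()
  ... | no  _ rewrite u~v = λ ()

  neighbours : Fin n → List (Fin n)
  neighbours v = filterᵇ (adj v) (allFin n)

  ∈-neighbours : ∀ {u v} → Adj G v u → u ∈ neighbours v
  ∈-neighbours {v = v} v~u = ∈-filter⁺ (T? ∘ adj v) (∈-allFin _) (subst T (sym v~u) tt)

  length-neighbours : ∀ v → length (neighbours v) ≤ Δ G
  length-neighbours v = subst (_≤ Δ G) (sym (length-filterᵇ {Fin n} (adj v) (allFin n)))
    (≤-foldr-⊔ {Fin n} (degree G) (allFin n) (∈-allFin v))

  -- c is a neighbour of w whenever w is a neighbour of c, so redirecting c to w adds w to the
  -- neighbours of w without lengthening the list; this keeps ball₂-probes within Δ² entries.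
  redirect : Fin n → Fin n → Fin n → Fin n
  redirect c w u = if does (u ≟ c) then w else u

  redirect-source : ∀ c w → redirect c w c ≡ w
  redirect-source c w with c ≟ c
  ... | yes _   = refl
  ... | no  c≢c = ⊥-elim (c≢c refl)

  redirect-other : ∀ c w {u} → u ≢ c → redirect c w u ≡ u
  redirect-other c w {u} u≢c with u ≟ c
  ... | yes u≡c = ⊥-elim (u≢c u≡c)
  ... | no  _   = refl

  redirected-neighbours : Fin n → Fin n → List (Fin n)
  redirected-neighbours c w = map (redirect c w) (neighbours w)

  ball₂-probes : Fin n → List (Fin n)
  ball₂-probes c = concatMap (redirected-neighbours c) (neighbours c)

  length-ball₂-probes : ∀ c → length (ball₂-probes c) ≤ Δ G * Δ G
  length-ball₂-probes c = ≤-trans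
    (length-concatMap-≤ (redirected-neighbours c) (neighbours c)
      (λ {w} _ → subst (_≤ Δ G) (sym (length-map (redirect c w) (neighbours w)))
                   (length-neighbours w)))
    (*-monoˡ-≤ (Δ G) (length-neighbours c))

  ∈-ball₂-probes-via : ∀ {c w x} → Adj G c w → Adj G w x → x ≢ c → x ∈ ball₂-probes c
  ∈-ball₂-probes-via {c} {w} c~w w~x x≢c =
    ∈-concatMap⁺ (redirected-neighbours c) (lose (∈-neighbours c~w)
      (subst (_∈ redirected-neighbours c w) (redirect-other c w x≢c)
        (∈-map⁺ (redirect c w) (∈-neighbours w~x))))

  ∈-ball₂-probes-adj : ∀ {c x} → Adj G c x → x ∈ ball₂-probes c
  ∈-ball₂-probes-adj {c} {x} c~x =
    ∈-concatMap⁺ (redirected-neighbours c) (lose (∈-neighbours c~x)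
      (subst (_∈ redirected-neighbours c x) (redirect-source c x)
        (∈-map⁺ (redirect c x) (∈-neighbours (trans (symmetric x c) c~x)))))

  ∈-ball₂-probes : ∀ {c x} → N[ G ] (N[ G ] ｛ c ｝) x → x ≢ c → x ∈ ball₂-probes c
  ∈-ball₂-probes (_ , (_ , refl , inj₁ refl) , inj₁ refl) x≢c = ⊥-elim (x≢c refl)
  ∈-ball₂-probes (_ , (_ , refl , inj₁ refl) , inj₂ c~x)  _   = ∈-ball₂-probes-adj c~x
  ∈-ball₂-probes (_ , (_ , refl , inj₂ c~x)  , inj₁ refl) _   = ∈-ball₂-probes-adj c~x
  ∈-ball₂-probes (_ , (_ , refl , inj₂ c~w)  , inj₂ w~x)  x≢c = ∈-ball₂-probes-via c~w w~x x≢c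

  sameAns-at-probe : ∀ {k} (Q : Fin k → Fin n) {u v} i → Q i ≡ v → SameAns G Q u v → u ≡ v
  sameAns-at-probe Q {u} i refl same =
    sym (resp≡0⇒≡ (Q i) u (trans (same i) (resp-self (Q i))))

  locWin-if-probes-cover : ∀ {k} {T : VSet G} (Q : Fin k → Fin n) c →
    (∀ {x} → T x → x ≢ c → ∃ λ i → Q i ≡ x) → LocWin G k T
  locWin-if-probes-cover {T = T} Q c covers =
    round Q λ v Tv → inj₁ λ u Tu same → separate Tu Tv same
    where
    separate : ∀ {u v} → T u → T v → SameAns G Q u v → u ≡ v
    separate {u} {v} Tu Tv same with v ≟ c | u ≟ c
    ... | no v≢c  | _       = let i , Qi≡v = covers Tv v≢c in sameAns-at-probe Q i Qi≡v same
    ... | yes _   | no u≢c  = let i , Qi≡u = covers Tu u≢c in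
                              sym (sameAns-at-probe Q i Qi≡u λ j → sym (same j))
    ... | yes v≡c | yes u≡c = trans u≡c (sym v≡c)

  locWin-in-ball₂ : ∀ {k} {T : VSet G} → Δ G * Δ G ≤ k →
    ∀ c → T ⊆ N[ G ] (N[ G ] ｛ c ｝) → LocWin G k T
  locWin-in-ball₂ Δ²≤k c T⊆ball = locWin-if-probes-cover (enumerate c (ball₂-probes c) fits) c
    (λ Tx x≢c → enumerate-surjective c (ball₂-probes c) fits (∈-ball₂-probes (T⊆ball Tx) x≢c))
    where
    fits : length (ball₂-probes c) ≤ _
    fits = ≤-trans (length-ball₂-probes c) Δ²≤k

  module _ {k} (Δ²≤k : Δ G * Δ G ≤ k) where

    locWin-after-sighting : ∀ {T : VSet G} (P : Fin k → Fin n) →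
      (∀ {v} → T v → AllStar G P v → LocWin G k (N[ G ] (T ∩ λ u → SameAns G P u v))) →
      LocWin G k T
    locWin-after-sighting {T} P unseen = round P λ v Tv → inj₂ (continue Tv)
      where
      continue : ∀ {v} → T v → LocWin G k (N[ G ] (T ∩ λ u → SameAns G P u v))
      continue {v} Tv with allStar? P v
      ... | yes ∗v = unseen Tv ∗v
      ... | no ¬∗v with ¬∀⟶∃¬ k _ (λ i → resp G (P i) v ≟∗) ¬∗v
      ...   | i , seen = locWin-in-ball₂ Δ²≤k (P i) (N-mono λ (_ , same) →
                resp≢∗⇒∈N (P i) _ λ r≡∗ → seen (trans (sym (same i)) r≡∗))

    proxWin⇒locWin : ∀ {S T : VSet G} → ProxWin G k S → T ⊆ S → LocWin G k T
    proxWin⇒locWin (round P (inj₁ noneUnseen)) T⊆S =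
      locWin-after-sighting P λ Tv ∗v → ⊥-elim (noneUnseen _ (T⊆S Tv) ∗v)
    proxWin⇒locWin (round P (inj₂ next)) T⊆S =
      locWin-after-sighting P λ Tv ∗v → proxWin⇒locWin next
        (N-mono λ (Tu , same) → T⊆S Tu , λ i → trans (same i) (∗v i))

  locWin⇒proxWin : ∀ {k} {S T : VSet G} → Fin k → LocWin G k S → T ⊆ S → Decidable T →
    ProxWin G k T
  locWin⇒proxWin {k} {S} {T} i₀ (round P strategy) T⊆S T?
    with any? (λ v → T? v ×-dec allStar? P v)
  ... | no noneUnseen     = round P (inj₁ λ v Tv ∗v → noneUnseen (v , Tv , ∗v))
  ... | yes (v , Tv , ∗v) = round P (inj₂ (follow (strategy v (T⊆S Tv))))
    where
    unseen⊆same : (T ∩ AllStar G P) ⊆ (S ∩ λ u → SameAns G P u v)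
    unseen⊆same (Tu , ∗u) = T⊆S Tu , λ i → trans (∗u i) (sym (∗v i))

    follow : (∀ u → S u → SameAns G P u v → u ≡ v)
             ⊎ LocWin G k (N[ G ] (S ∩ λ u → SameAns G P u v)) →
             ProxWin G k (N[ G ] (T ∩ AllStar G P))
    follow (inj₁ located) = round (λ _ → v) (inj₁ λ x x∈N ∗x → ∈N⇒resp≢∗ v x
      (N-mono (λ u∈ → let Su , same = unseen⊆same u∈ in sym (located _ Su same)) x∈N) (∗x i₀))
    follow (inj₂ next) = locWin⇒proxWin i₀ next (N-mono unseen⊆same)
      (N? (λ u → T? u ×-dec allStar? P u))

locCopsWin⇒proxCopsWin : ∀ (G : Graph) {k} → 1 ≤ k → LocCopsWin G k → ProxCopsWin G k
locCopsWin⇒proxCopsWin G {suc k} _ win = locWin⇒proxWin G fzero win id (λ _ → yes tt)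

proxCopsWin⇒locCopsWin : ∀ (G : Graph) {k} → Δ G * Δ G ≤ k → ProxCopsWin G k → LocCopsWin G k
proxCopsWin⇒locCopsWin G Δ²≤k win = proxWin⇒locWin G Δ²≤k win id

mainTheorem14 : (G : Graph) (p : ℕ) → IsProx1 G p →
    Δ G * Δ G ≤ p → IsZeta1 G p
mainTheorem14 G p (1≤p , pWins , pMinimal) Δ²≤p =
  1≤p , proxCopsWin⇒locCopsWin G Δ²≤p pWins ,
  λ k 1≤k kWins → pMinimal k 1≤k (locCopsWin⇒proxCopsWin G 1≤k kWins)
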